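{- Let $V=\mathbb{F}_2^n$ with $n\ge 3$, and identify the anti-flags of $\mathrm{PG}(n-1,2)$ with the non-singular points of the quadratic form $Q$ on $V\times V^*$ via the bijection $f$ described below. Then the hyperbolic polar space $\mathcal{O}^+(2n,2)$ (its singular points and singular lines) can be recovered from the graph $\Gamma_1$; in particular every automorphism of $\Gamma_1$ induces an automorphism of the polar space $\mathcal{O}^+(2n,2)$.
   Context: An anti-flag of $\mathrm{PG}(n-1,2)$ is a pair $(p,H)$ of a point $p$ and a hyperplane $H$ with $p\notin H$. For distinct anti-flags, $(p_1,H_1)\sim_1(p_2,H_2)$ iff $p_j\in H_{3-j}$ and $p_{3-j}\notin H_j$ for some $j\in\{1,2\}$; $\Gamma_1$ is the graph on anti-flags with adjacency $\sim_1$. On $W=V\times V^*$ define $Q(x,x^*)=x^*(x)$ (a non-degenerate hyperbolic quadratic form). A point $\langle w\rangle$ of $\mathrm{PG}(2n-1,2)$ is singular if $Q(w)=0$ and non-singular otherwise. The map $f:\langle(x,x^*)\rangle\mapsto(\langle x\rangle,\ker x^*)$ is a bijection from non-singular points to anti-flags. The polar space $\mathcal{O}^+(2n,2)$ is the point-line geometry of singular points and singular lines (lines all of whose points are singular); its automorphisms are permutations of singular points mapping singular lines to singular lines. -}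

module Defs where

open import Data.Bool using (Bool; true; false; _xor_; _∧_; _∨_; not)
open import Data.Nat using (ℕ; zero; suc)
open import Data.Vec using (Vec; []; _∷_; zipWith; replicate)
open import Data.Product using (Σ; _×_; _,_; proj₁; proj₂)
open import Data.Sum using (_⊎_)
open import Relation.Binary.PropositionalEquality using (_≡_; _≢_; refl)
open import Relation.Nullary using (¬_)
open import Function.Bundles using (_⤖_; Bijection)

-- The field F₂ = Bool (addition = xor, multiplication = ∧),
-- V = F₂ⁿ as Vec Bool n.  A dual vector x* ∈ V* is represented by its
-- coordinate vector, acting by  x*(x) = Σᵢ x*ᵢ xᵢ  (standard dual basis).

V : ℕ → Set
V n = Vec Bool n

_⊕_ : ∀ {n} → V n → V n → V n
_⊕_ = zipWith _xor_

ev : ∀ {n} → V n → V n → Bool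
ev [] [] = false
ev (a ∷ as) (b ∷ bs) = (a ∧ b) xor ev as bs

nz : ∀ {n} → V n → Bool
nz [] = false
nz (a ∷ as) = a ∨ nz as

-- PG(n-1,2): over F₂ a projective point is a nonzero vector, and a
-- hyperplane is the kernel of a nonzero functional (distinct nonzero
-- functionals have distinct kernels).  p ∈ H = ker h  iff  h(p) = 0.

AntiFlag : ℕ → Set
AntiFlag n = Σ (V n × V n) λ ph →
  (nz (proj₁ ph) ≡ true) × (nz (proj₂ ph) ≡ true) × (ev (proj₂ ph) (proj₁ ph) ≡ true)

point : ∀ {n} → AntiFlag n → V n
point a = proj₁ (proj₁ a)

hypfun : ∀ {n} → AntiFlag n → V n
hypfun a = proj₂ (proj₁ a)

_∈H_ : ∀ {n} → V n → AntiFlag n → Set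
p ∈H b = ev (hypfun b) p ≡ false

_∼₁_ : ∀ {n} → AntiFlag n → AntiFlag n → Set
a₁ ∼₁ a₂ = (a₁ ≢ a₂) ×
  (((point a₁ ∈H a₂) × ¬ (point a₂ ∈H a₁)) ⊎ ((point a₂ ∈H a₁) × ¬ (point a₁ ∈H a₂)))

record AutΓ₁ (n : ℕ) : Set where
  field
    bij : AntiFlag n ⤖ AntiFlag n
    adj : ∀ a b → (a ∼₁ b → Bijection.to bij a ∼₁ Bijection.to bij b)
                × (Bijection.to bij a ∼₁ Bijection.to bij b → a ∼₁ b)

W : ℕ → Set
W n = V n × V n

_⊞_ : ∀ {n} → W n → W n → W n
(x , x*) ⊞ (y , y*) = (x ⊕ y , x* ⊕ y*)

Q : ∀ {n} → W n → Bool
Q (x , x*) = ev x* x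

B : ∀ {n} → W n → W n → Bool
B u v = Q (u ⊞ v) xor Q u xor Q v

nzW : ∀ {n} → W n → Bool
nzW (x , x*) = nz x ∨ nz x*

-- points of PG(2n-1,2) are nonzero vectors of W
SingularPoint : ℕ → Set
SingularPoint n = Σ (W n) λ w → (nzW w ≡ true) × (Q w ≡ false)

NonSingularPoint : ℕ → Set
NonSingularPoint n = Σ (W n) λ w → Q w ≡ true

-- (a non-singular vector is automatically nonzero)
ev-nz : ∀ {n} (h p : V n) → ev h p ≡ true → nz p ≡ true
ev-nz [] [] ()
ev-nz (false ∷ h) (b ∷ p) e = lem b (ev-nz h p e)
  where
  lem : ∀ b → {x : Bool} → x ≡ true → b ∨ x ≡ true
  lem true _ = refl
  lem false e = e
ev-nz (true ∷ h) (true ∷ p) e = refl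
ev-nz (true ∷ h) (false ∷ p) e = ev-nz h p e

ev-nz* : ∀ {n} (h p : V n) → ev h p ≡ true → nz h ≡ true
ev-nz* [] [] ()
ev-nz* (true ∷ h) (b ∷ p) e = refl
ev-nz* (false ∷ h) (b ∷ p) e = ev-nz* h p e

f : ∀ {n} → NonSingularPoint n → AntiFlag n
f ((x , x*) , q) = (x , x*) , ev-nz x* x q , ev-nz* x* x q , q

-- s₁ , s₂ , s₃ are the three points of a singular line (the line of
-- PG(2n-1,2) through distinct s₁ , s₂ is {s₁ , s₂ , s₁ + s₂}; the line is
-- singular since all three are singular points)
SingLine : ∀ {n} → SingularPoint n → SingularPoint n → SingularPoint n → Set
SingLine s₁ s₂ s₃ = (s₁ ≢ s₂) × (proj₁ s₃ ≡ proj₁ s₁ ⊞ proj₁ s₂)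

record PolarAut (n : ℕ) : Set where
  field
    bij : SingularPoint n ⤖ SingularPoint n
    lines : ∀ s₁ s₂ s₃ → SingLine s₁ s₂ s₃ →
      SingLine (Bijection.to bij s₁) (Bijection.to bij s₂) (Bijection.to bij s₃)

{-# OPTIONS --safe #-}
-- Over F₂ the anti-flags f w and f u are adjacent in Γ₁ exactly when B w u = 1, so an automorphism
-- of Γ₁ is a permutation h of the non-singular points preserving the polar form B. For n ≥ 2 every
-- singular vector s splits as s = w + w′ with w, w′ non-singular and B w w′ = 0; put σ s = h w + h w′.
-- Then B (σ s) (h u) = B s u for every non-singular u, and non-singular vectors separate the vectors
-- of W, so σ is injective, additive and (by the same construction for h⁻¹) surjective; moreover σ s
-- is singular because Q (h w + h w′) = B w w′ = 0.
module Submission where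

open import Defs
open import Data.Nat using (ℕ; _≤_; _+_; zero; suc; s≤s)
open import Data.Product using (Σ; _×_; _,_; proj₁; proj₂)
open import Data.Sum using (_⊎_; inj₁; inj₂)
open import Data.Bool using (Bool; true; false; _xor_; _∧_; _∨_)
open import Data.Bool.Properties
  using (xor-assoc; xor-comm; xor-same; xor-identityʳ; ∧-comm; ∧-identityʳ; ∧-zeroʳ;
         ∧-distribʳ-xor; not-involutive; ⇔→≡; xor-∧-commutativeRing)
  renaming (_≟_ to _≟ᵇ_)
open import Data.Vec using ([]; _∷_; _++_; replicate)
open import Algebra.Bundles using (CommutativeRing)
open import Algebra.Properties.CommutativeSemigroup
  (CommutativeRing.+-commutativeSemigroup xor-∧-commutativeRing)
  using () renaming (interchange to xor-interchange)
open import Axiom.UniquenessOfIdentityProofs using (module Decidable⇒UIP)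
open import Function using (_∘_)
open import Function.Bundles using (Bijection; mk⤖; mk⇔)
open import Function.Consequences.Propositional using (strictlySurjective⇒surjective)
open import Function.Definitions using (Bijective)
open import Relation.Binary.PropositionalEquality
  using (_≡_; _≢_; refl; sym; trans; cong; cong₂; subst₂; module ≡-Reasoning)
open import Relation.Nullary using (contradiction)

open ≡-Reasoning

xor-cancelˡ : ∀ x y → x xor (x xor y) ≡ y
xor-cancelˡ false y = refl
xor-cancelˡ true  y = not-involutive y

xor-cancelʳ : ∀ x y → (x xor y) xor y ≡ x
xor-cancelʳ x y = begin
  (x xor y) xor y  ≡⟨ xor-assoc x y y ⟩
  x xor (y xor y)  ≡⟨ cong (x xor_) (xor-same y) ⟩
  x xor false      ≡⟨ xor-identityʳ x ⟩
  x                ∎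

Bool-irrelevant : {x y : Bool} (p q : x ≡ y) → p ≡ q
Bool-irrelevant = Decidable⇒UIP.≡-irrelevant _≟ᵇ_

0v : ∀ {n} → V n
0v = replicate _ false

0W : ∀ {n} → W n
0W = 0v , 0v

⊕-cancelˡ : ∀ {n} (x y : V n) → x ⊕ (x ⊕ y) ≡ y
⊕-cancelˡ []       []       = refl
⊕-cancelˡ (a ∷ x) (b ∷ y) = cong₂ _∷_ (xor-cancelˡ a b) (⊕-cancelˡ x y)

⊞-cancelˡ : ∀ {n} (u v : W n) → u ⊞ (u ⊞ v) ≡ v
⊞-cancelˡ (x , x*) (y , y*) = cong₂ _,_ (⊕-cancelˡ x y) (⊕-cancelˡ x* y*)

nz-0v : ∀ {n} → nz (0v {n}) ≡ false
nz-0v {zero}  = refl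
nz-0v {suc n} = nz-0v {n}

nz-false⇒0v : ∀ {n} (x : V n) → nz x ≡ false → x ≡ 0v
nz-false⇒0v []          _ = refl
nz-false⇒0v (false ∷ x) e = cong (false ∷_) (nz-false⇒0v x e)

nzW-true⇒≢0W : ∀ {n} {w : W n} → nzW w ≡ true → w ≢ 0W
nzW-true⇒≢0W {n} e refl with () ← trans (sym e) (cong₂ _∨_ (nz-0v {n}) (nz-0v {n}))

≢0W⇒nzW-true : ∀ {n} (w : W n) → w ≢ 0W → nzW w ≡ true
≢0W⇒nzW-true (x , x*) w≢0 with nz x in ex | nz x* in ex*
... | true  | _     = refl
... | false | true  = refl
... | false | false = contradiction (cong₂ _,_ (nz-false⇒0v x ex) (nz-false⇒0v x* ex*)) w≢0

ev-zeroˡ : ∀ {n} (p : V n) → ev 0v p ≡ false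
ev-zeroˡ []      = refl
ev-zeroˡ (_ ∷ p) = ev-zeroˡ p

ev-comm : ∀ {n} (h p : V n) → ev h p ≡ ev p h
ev-comm []      []      = refl
ev-comm (a ∷ h) (b ∷ p) = cong₂ _xor_ (∧-comm a b) (ev-comm h p)

ev-zeroʳ : ∀ {n} (h : V n) → ev h 0v ≡ false
ev-zeroʳ h = trans (ev-comm h 0v) (ev-zeroˡ h)

ev-distribʳ-⊕ : ∀ {n} (h h′ p : V n) → ev (h ⊕ h′) p ≡ ev h p xor ev h′ p
ev-distribʳ-⊕ []      []        []      = refl
ev-distribʳ-⊕ (a ∷ h) (a′ ∷ h′) (b ∷ p) = begin
  ((a xor a′) ∧ b) xor ev (h ⊕ h′) p               ≡⟨ cong₂ _xor_ (∧-distribʳ-xor b a a′) (ev-distribʳ-⊕ h h′ p) ⟩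
  ((a ∧ b) xor (a′ ∧ b)) xor (ev h p xor ev h′ p)  ≡⟨ xor-interchange (a ∧ b) (a′ ∧ b) (ev h p) (ev h′ p) ⟩
  ((a ∧ b) xor ev h p) xor ((a′ ∧ b) xor ev h′ p)  ∎

ev-distribˡ-⊕ : ∀ {n} (h p p′ : V n) → ev h (p ⊕ p′) ≡ ev h p xor ev h p′
ev-distribˡ-⊕ h p p′ = begin
  ev h (p ⊕ p′)          ≡⟨ ev-comm h (p ⊕ p′) ⟩
  ev (p ⊕ p′) h          ≡⟨ ev-distribʳ-⊕ p p′ h ⟩
  ev p h xor ev p′ h     ≡⟨ cong₂ _xor_ (ev-comm p h) (ev-comm p′ h) ⟩
  ev h p xor ev h p′     ∎

ev-++ : ∀ {m k} (h p : V m) (h′ p′ : V k) → ev (h ++ h′) (p ++ p′) ≡ ev h p xor ev h′ p′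
ev-++ []      []      h′ p′ = refl
ev-++ (a ∷ h) (b ∷ p) h′ p′ =
  trans (cong ((a ∧ b) xor_) (ev-++ h p h′ p′)) (sym (xor-assoc (a ∧ b) (ev h p) (ev h′ p′)))

ev-extensional : ∀ {n} (h h′ : V n) → (∀ p → ev h p ≡ ev h′ p) → h ≡ h′
ev-extensional []      []        _     = refl
ev-extensional (a ∷ h) (a′ ∷ h′) agree = cong₂ _∷_ heads tails
  where
  ev-first : ∀ {n} b (g : V n) → ev (b ∷ g) (true ∷ 0v) ≡ b
  ev-first b g = trans (cong₂ _xor_ (∧-identityʳ b) (ev-zeroʳ g)) (xor-identityʳ b)

  ev-rest : ∀ {n} b (g p : V n) → ev (b ∷ g) (false ∷ p) ≡ ev g p
  ev-rest b g p = cong (_xor ev g p) (∧-zeroʳ b)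

  heads : a ≡ a′
  heads = trans (sym (ev-first a h)) (trans (agree (true ∷ 0v)) (ev-first a′ h′))

  tails : h ≡ h′
  tails = ev-extensional h h′ λ p →
    trans (sym (ev-rest a h p)) (trans (agree (false ∷ p)) (ev-rest a′ h′ p))

B-formula : ∀ {n} (x x* y y* : V n) → B (x , x*) (y , y*) ≡ ev x* y xor ev y* x
B-formula x x* y y* = begin
  ev (x* ⊕ y*) (x ⊕ y) xor (xx xor yy)           ≡⟨ cong (_xor (xx xor yy)) expand ⟩
  ((xx xor xy) xor (yx xor yy)) xor (xx xor yy)  ≡⟨ cong (λ t → ((xx xor xy) xor t) xor (xx xor yy)) (xor-comm yx yy) ⟩
  ((xx xor xy) xor (yy xor yx)) xor (xx xor yy)  ≡⟨ cong (_xor (xx xor yy)) (xor-interchange xx xy yy yx) ⟩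
  ((xx xor yy) xor (xy xor yx)) xor (xx xor yy)  ≡⟨ cong (_xor (xx xor yy)) (xor-comm (xx xor yy) (xy xor yx)) ⟩
  ((xy xor yx) xor (xx xor yy)) xor (xx xor yy)  ≡⟨ xor-cancelʳ (xy xor yx) (xx xor yy) ⟩
  xy xor yx                                      ∎
  where
  xx xy yx yy : Bool
  xx = ev x* x
  xy = ev x* y
  yx = ev y* x
  yy = ev y* y

  expand : ev (x* ⊕ y*) (x ⊕ y) ≡ (xx xor xy) xor (yx xor yy)
  expand = trans (ev-distribʳ-⊕ x* y* (x ⊕ y)) (cong₂ _xor_ (ev-distribˡ-⊕ x* x y) (ev-distribˡ-⊕ y* x y))

B-comm : ∀ {n} (u v : W n) → B u v ≡ B v u
B-comm (x , x*) (y , y*) = begin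
  B (x , x*) (y , y*)   ≡⟨ B-formula x x* y y* ⟩
  ev x* y xor ev y* x   ≡⟨ xor-comm (ev x* y) (ev y* x) ⟩
  ev y* x xor ev x* y   ≡⟨ B-formula y y* x x* ⟨
  B (y , y*) (x , x*)   ∎

B-self : ∀ {n} (w : W n) → B w w ≡ false
B-self (x , x*) = trans (B-formula x x* x x*) (xor-same (ev x* x))

B-distribʳ-⊞ : ∀ {n} (u v c : W n) → B (u ⊞ v) c ≡ B u c xor B v c
B-distribʳ-⊞ (x , x*) (z , z*) (y , y*) = begin
  B (x ⊕ z , x* ⊕ z*) (y , y*)                     ≡⟨ B-formula (x ⊕ z) (x* ⊕ z*) y y* ⟩
  ev (x* ⊕ z*) y xor ev y* (x ⊕ z)                 ≡⟨ cong₂ _xor_ (ev-distribʳ-⊕ x* z* y) (ev-distribˡ-⊕ y* x z) ⟩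
  (ev x* y xor ev z* y) xor (ev y* x xor ev y* z)  ≡⟨ xor-interchange (ev x* y) (ev z* y) (ev y* x) (ev y* z) ⟩
  (ev x* y xor ev y* x) xor (ev z* y xor ev y* z)  ≡⟨ cong₂ _xor_ (B-formula x x* y y*) (B-formula z z* y y*) ⟨
  B (x , x*) (y , y*) xor B (z , z*) (y , y*)      ∎

B-distribˡ-⊞ : ∀ {n} (c u v : W n) → B c (u ⊞ v) ≡ B c u xor B c v
B-distribˡ-⊞ c u v = begin
  B c (u ⊞ v)         ≡⟨ B-comm c (u ⊞ v) ⟩
  B (u ⊞ v) c         ≡⟨ B-distribʳ-⊞ u v c ⟩
  B u c xor B v c     ≡⟨ cong₂ _xor_ (B-comm u c) (B-comm v c) ⟩
  B c u xor B c v     ∎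

B-zeroˡ : ∀ {n} (w : W n) → B 0W w ≡ false
B-zeroˡ (y , y*) = trans (B-formula 0v 0v y y*) (cong₂ _xor_ (ev-zeroˡ y) (ev-zeroʳ y*))

B-against-functional : ∀ {n} (x x* y* : V n) → B (x , x*) (0v , y*) ≡ ev y* x
B-against-functional x x* y* = trans (B-formula x x* 0v y*) (cong (_xor ev y* x) (ev-zeroʳ x*))

B-against-point : ∀ {n} (x x* y : V n) → B (x , x*) (y , 0v) ≡ ev x* y
B-against-point x x* y =
  trans (B-formula x x* y 0v) (trans (cong (ev x* y xor_) (ev-zeroˡ x)) (xor-identityʳ (ev x* y)))

B-extensional : ∀ {n} {a b : W n} → (∀ v → B a v ≡ B b v) → a ≡ b
B-extensional {a = x , x*} {z , z*} agree = cong₂ _,_ points functionals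
  where
  points : x ≡ z
  points = ev-extensional x z λ p → begin
    ev x p                   ≡⟨ ev-comm x p ⟩
    ev p x                   ≡⟨ B-against-functional x x* p ⟨
    B (x , x*) (0v , p)      ≡⟨ agree (0v , p) ⟩
    B (z , z*) (0v , p)      ≡⟨ B-against-functional z z* p ⟩
    ev p z                   ≡⟨ ev-comm p z ⟩
    ev z p                   ∎

  functionals : x* ≡ z*
  functionals = ev-extensional x* z* λ p → begin
    ev x* p                  ≡⟨ B-against-point x x* p ⟨
    B (x , x*) (p , 0v)      ≡⟨ agree (p , 0v) ⟩
    B (z , z*) (p , 0v)      ≡⟨ B-against-point z z* p ⟩
    ev z* p                  ∎

Q-⊞ : ∀ {n} (u v : W n) → Q (u ⊞ v) ≡ B u v xor (Q u xor Q v)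
Q-⊞ u v = sym (xor-cancelʳ (Q (u ⊞ v)) (Q u xor Q v))

Q-0W : ∀ {n} → Q (0W {n}) ≡ false
Q-0W {n} = ev-zeroˡ (0v {n})

_++ᵂ_ : ∀ {m k} → W m → W k → W (m + k)
(x , x*) ++ᵂ (y , y*) = x ++ y , x* ++ y*

Q-++ᵂ : ∀ {m k} (u : W m) (u′ : W k) → Q (u ++ᵂ u′) ≡ Q u xor Q u′
Q-++ᵂ (x , x*) (y , y*) = ev-++ x* x y* y

B-++ᵂ : ∀ {m k} (s u : W m) (s′ u′ : W k) → B (s ++ᵂ s′) (u ++ᵂ u′) ≡ B s u xor B s′ u′
B-++ᵂ (x , x*) (y , y*) (x′ , x*′) (y′ , y*′) = begin
  B (x ++ x′ , x* ++ x*′) (y ++ y′ , y* ++ y*′)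
    ≡⟨ B-formula (x ++ x′) (x* ++ x*′) (y ++ y′) (y* ++ y*′) ⟩
  ev (x* ++ x*′) (y ++ y′) xor ev (y* ++ y*′) (x ++ x′)
    ≡⟨ cong₂ _xor_ (ev-++ x* y x*′ y′) (ev-++ y* x y*′ x′) ⟩
  (ev x* y xor ev x*′ y′) xor (ev y* x xor ev y*′ x′)
    ≡⟨ xor-interchange (ev x* y) (ev x*′ y′) (ev y* x) (ev y*′ x′) ⟩
  (ev x* y xor ev y* x) xor (ev x*′ y′ xor ev y*′ x′)
    ≡⟨ cong₂ _xor_ (B-formula x x* y y*) (B-formula x′ x*′ y′ y*′) ⟨
  B (x , x*) (y , y*) xor B (x′ , x*′) (y′ , y*′)
    ∎

-- This is where n ≥ 2 is needed: in W 1 the only non-singular vector (1 , 1) is not orthogonal to (1 , 0).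
orthogonal-nonsingular₂ : (s : W 2) → Σ (NonSingularPoint 2) λ u → B s (proj₁ u) ≡ false
orthogonal-nonsingular₂ (true ∷ true ∷ [] , true ∷ true ∷ []) = ((true ∷ false ∷ [] , true ∷ false ∷ []) , refl) , refl
orthogonal-nonsingular₂ (true ∷ true ∷ [] , true ∷ false ∷ []) = ((true ∷ false ∷ [] , true ∷ false ∷ []) , refl) , refl
orthogonal-nonsingular₂ (true ∷ true ∷ [] , false ∷ true ∷ []) = ((true ∷ true ∷ [] , true ∷ false ∷ []) , refl) , refl
orthogonal-nonsingular₂ (true ∷ true ∷ [] , false ∷ false ∷ []) = ((true ∷ false ∷ [] , true ∷ true ∷ []) , refl) , refl
orthogonal-nonsingular₂ (true ∷ false ∷ [] , true ∷ true ∷ []) = ((true ∷ false ∷ [] , true ∷ false ∷ []) , refl) , refl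
orthogonal-nonsingular₂ (true ∷ false ∷ [] , true ∷ false ∷ []) = ((true ∷ false ∷ [] , true ∷ false ∷ []) , refl) , refl
orthogonal-nonsingular₂ (true ∷ false ∷ [] , false ∷ true ∷ []) = ((true ∷ true ∷ [] , true ∷ false ∷ []) , refl) , refl
orthogonal-nonsingular₂ (true ∷ false ∷ [] , false ∷ false ∷ []) = ((false ∷ true ∷ [] , false ∷ true ∷ []) , refl) , refl
orthogonal-nonsingular₂ (false ∷ true ∷ [] , true ∷ true ∷ []) = ((true ∷ true ∷ [] , true ∷ false ∷ []) , refl) , refl
orthogonal-nonsingular₂ (false ∷ true ∷ [] , true ∷ false ∷ []) = ((true ∷ false ∷ [] , true ∷ true ∷ []) , refl) , refl
orthogonal-nonsingular₂ (false ∷ true ∷ [] , false ∷ true ∷ []) = ((true ∷ false ∷ [] , true ∷ false ∷ []) , refl) , refl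
orthogonal-nonsingular₂ (false ∷ true ∷ [] , false ∷ false ∷ []) = ((true ∷ false ∷ [] , true ∷ false ∷ []) , refl) , refl
orthogonal-nonsingular₂ (false ∷ false ∷ [] , true ∷ true ∷ []) = ((true ∷ true ∷ [] , true ∷ false ∷ []) , refl) , refl
orthogonal-nonsingular₂ (false ∷ false ∷ [] , true ∷ false ∷ []) = ((false ∷ true ∷ [] , false ∷ true ∷ []) , refl) , refl
orthogonal-nonsingular₂ (false ∷ false ∷ [] , false ∷ true ∷ []) = ((true ∷ false ∷ [] , true ∷ false ∷ []) , refl) , refl
orthogonal-nonsingular₂ (false ∷ false ∷ [] , false ∷ false ∷ []) = ((true ∷ false ∷ [] , true ∷ false ∷ []) , refl) , refl

orthogonal-nonsingular : ∀ {k} (s : W (2 + k)) → Σ (NonSingularPoint (2 + k)) λ u → B s (proj₁ u) ≡ false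
orthogonal-nonsingular {k} (a ∷ b ∷ x , c ∷ d ∷ x*)
  with orthogonal-nonsingular₂ (a ∷ b ∷ [] , c ∷ d ∷ [])
... | (u , nonsingular) , s₂⊥u =
  (u ++ᵂ 0W , trans (Q-++ᵂ u 0W) (cong₂ _xor_ nonsingular (Q-0W {k}))) ,
  trans (B-++ᵂ (a ∷ b ∷ [] , c ∷ d ∷ []) u (x , x*) 0W) (cong₂ _xor_ s₂⊥u (trans (B-comm (x , x*) 0W) (B-zeroˡ (x , x*))))

record NonSingularSplitting {n} (v : W n) : Set where
  field
    left right : NonSingularPoint n
    sum        : v ≡ proj₁ left ⊞ proj₁ right
    orthogonal : B (proj₁ left) (proj₁ right) ≡ false

singular-split : ∀ {k} (v : W (2 + k)) → Q v ≡ false → NonSingularSplitting v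
singular-split v singular with orthogonal-nonsingular v
... | (w , nonsingular) , v⊥w = record
  { left       = w , nonsingular
  ; right      = w ⊞ v , Q-sum
  ; sum        = sym (⊞-cancelˡ w v)
  ; orthogonal = w⊥w+v
  }
  where
  w⊥v : B w v ≡ false
  w⊥v = trans (B-comm w v) v⊥w

  Q-sum : Q (w ⊞ v) ≡ true
  Q-sum = trans (Q-⊞ w v) (cong₂ _xor_ w⊥v (cong₂ _xor_ nonsingular singular))

  w⊥w+v : B w (w ⊞ v) ≡ false
  w⊥w+v = trans (B-distribˡ-⊞ w w v) (cong₂ _xor_ (B-self w) w⊥v)

nonsingular-separates : ∀ {k} {a b : W (2 + k)} →
  (∀ (u : NonSingularPoint (2 + k)) → B a (proj₁ u) ≡ B b (proj₁ u)) → a ≡ b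
nonsingular-separates {k} {a} {b} agree = B-extensional agree-everywhere
  where
  agree-everywhere : ∀ v → B a v ≡ B b v
  agree-everywhere v = by-cases (Q v) refl
    where
    by-cases : ∀ q → Q v ≡ q → B a v ≡ B b v
    by-cases true  nonsingular = agree (v , nonsingular)
    by-cases false singular    = begin
      B a v                  ≡⟨ cong (B a) sum ⟩
      B a (l ⊞ r)            ≡⟨ B-distribˡ-⊞ a l r ⟩
      B a l xor B a r        ≡⟨ cong₂ _xor_ (agree left) (agree right) ⟩
      B b l xor B b r        ≡⟨ B-distribˡ-⊞ b l r ⟨
      B b (l ⊞ r)            ≡⟨ cong (B b) sum ⟨
      B b v                  ∎
      where
      open NonSingularSplitting (singular-split v singular)
      l r : W (2 + k)
      l = proj₁ left
      r = proj₁ right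

SingularPoint-≡ : ∀ {n} {s s′ : SingularPoint n} → proj₁ s ≡ proj₁ s′ → s ≡ s′
SingularPoint-≡ {s = w , nz₁ , q₁} {.w , nz₂ , q₂} refl =
  cong₂ (λ p q → w , p , q) (Bool-irrelevant nz₁ nz₂) (Bool-irrelevant q₁ q₂)

module SingularImage {k} (h : NonSingularPoint (2 + k) → NonSingularPoint (2 + k))
  (h-preserves-B : ∀ w u → B (proj₁ (h w)) (proj₁ (h u)) ≡ B (proj₁ w) (proj₁ u)) where

  image : ∀ {v : W (2 + k)} → NonSingularSplitting v → W (2 + k)
  image sp = proj₁ (h left) ⊞ proj₁ (h right)
    where open NonSingularSplitting sp

  module _ {v : W (2 + k)} (sp : NonSingularSplitting v) where
    open NonSingularSplitting sp

    image-B : ∀ u → B (image sp) (proj₁ (h u)) ≡ B v (proj₁ u)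
    image-B u = begin
      B (hl ⊞ hr) (proj₁ (h u))                ≡⟨ B-distribʳ-⊞ hl hr (proj₁ (h u)) ⟩
      B hl (proj₁ (h u)) xor B hr (proj₁ (h u)) ≡⟨ cong₂ _xor_ (h-preserves-B left u) (h-preserves-B right u) ⟩
      B l (proj₁ u) xor B r (proj₁ u)           ≡⟨ B-distribʳ-⊞ l r (proj₁ u) ⟨
      B (l ⊞ r) (proj₁ u)                       ≡⟨ cong (λ t → B t (proj₁ u)) sum ⟨
      B v (proj₁ u)                             ∎
      where
      l r hl hr : W (2 + k)
      l = proj₁ left
      r = proj₁ right
      hl = proj₁ (h left)
      hr = proj₁ (h right)

    image-singular : Q (image sp) ≡ false
    image-singular = trans (Q-⊞ (proj₁ (h left)) (proj₁ (h right)))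
      (cong₂ _xor_ (trans (h-preserves-B left right) orthogonal)
                   (cong₂ _xor_ (proj₂ (h left)) (proj₂ (h right))))

    image-≢0W : v ≢ 0W → image sp ≢ 0W
    image-≢0W v≢0 image≡0 = v≢0 (nonsingular-separates λ u → begin
      B v (proj₁ u)                   ≡⟨ image-B u ⟨
      B (image sp) (proj₁ (h u))      ≡⟨ cong (λ t → B t (proj₁ (h u))) image≡0 ⟩
      B 0W (proj₁ (h u))              ≡⟨ B-zeroˡ (proj₁ (h u)) ⟩
      false                           ≡⟨ B-zeroˡ (proj₁ u) ⟨
      B 0W (proj₁ u)                  ∎)

    image-point : nzW v ≡ true → SingularPoint (2 + k)
    image-point nonzero =
      image sp , ≢0W⇒nzW-true (image sp) (image-≢0W (nzW-true⇒≢0W nonzero)) , image-singular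

  -- Abstract because σ s unfolds to the whole construction for every s, even a variable, and
  -- comparing two such unfoldings makes checking the bijectivity proofs below blow up.
  abstract
    σ : SingularPoint (2 + k) → SingularPoint (2 + k)
    σ (v , nonzero , singular) = image-point (singular-split v singular) nonzero

    σ-B : ∀ s u → B (proj₁ (σ s)) (proj₁ (h u)) ≡ B (proj₁ s) (proj₁ u)
    σ-B (v , _ , singular) = image-B (singular-split v singular)

record NonSingularIsometry (n : ℕ) : Set where
  field
    to from     : NonSingularPoint n → NonSingularPoint n
    to-from     : ∀ u → to (from u) ≡ u
    preserves-B : ∀ w u → B (proj₁ (to w)) (proj₁ (to u)) ≡ B (proj₁ w) (proj₁ u)

module InducedPolarAut {k} (φ : NonSingularIsometry (2 + k)) where
  open NonSingularIsometry φ

  from-preserves-B : ∀ w u → B (proj₁ (from w)) (proj₁ (from u)) ≡ B (proj₁ w) (proj₁ u)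
  from-preserves-B w u = trans (sym (preserves-B (from w) (from u)))
                               (cong₂ (λ a b → B (proj₁ a) (proj₁ b)) (to-from w) (to-from u))

  open SingularImage to preserves-B public using (σ; σ-B)
  private module Inverse = SingularImage from from-preserves-B

  σ-adjoint : ∀ s u → B (proj₁ (σ s)) (proj₁ u) ≡ B (proj₁ s) (proj₁ (from u))
  σ-adjoint s u = trans (cong (λ t → B (proj₁ (σ s)) (proj₁ t)) (sym (to-from u))) (σ-B s (from u))

  σ-injective : ∀ {s s′} → σ s ≡ σ s′ → s ≡ s′
  σ-injective {s} {s′} σs≡σs′ = SingularPoint-≡ (nonsingular-separates λ u → begin
    B (proj₁ s) (proj₁ u)                ≡⟨ σ-B s u ⟨
    B (proj₁ (σ s)) (proj₁ (to u))       ≡⟨ cong (λ t → B (proj₁ t) (proj₁ (to u))) σs≡σs′ ⟩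
    B (proj₁ (σ s′)) (proj₁ (to u))      ≡⟨ σ-B s′ u ⟩
    B (proj₁ s′) (proj₁ u)               ∎)

  σ-inverse : ∀ t → σ (Inverse.σ t) ≡ t
  σ-inverse t = SingularPoint-≡ (nonsingular-separates λ u →
    trans (σ-adjoint (Inverse.σ t) u) (Inverse.σ-B t u))

  σ-⊞ : ∀ {s₁ s₂ s₃} → proj₁ s₃ ≡ proj₁ s₁ ⊞ proj₁ s₂ → proj₁ (σ s₃) ≡ proj₁ (σ s₁) ⊞ proj₁ (σ s₂)
  σ-⊞ {s₁} {s₂} {s₃} s₃≡s₁+s₂ = nonsingular-separates λ u → begin
    B (proj₁ (σ s₃)) (proj₁ u)
      ≡⟨ σ-adjoint s₃ u ⟩
    B (proj₁ s₃) (proj₁ (from u))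
      ≡⟨ cong (λ t → B t (proj₁ (from u))) s₃≡s₁+s₂ ⟩
    B (proj₁ s₁ ⊞ proj₁ s₂) (proj₁ (from u))
      ≡⟨ B-distribʳ-⊞ (proj₁ s₁) (proj₁ s₂) (proj₁ (from u)) ⟩
    B (proj₁ s₁) (proj₁ (from u)) xor B (proj₁ s₂) (proj₁ (from u))
      ≡⟨ cong₂ _xor_ (σ-adjoint s₁ u) (σ-adjoint s₂ u) ⟨
    B (proj₁ (σ s₁)) (proj₁ u) xor B (proj₁ (σ s₂)) (proj₁ u)
      ≡⟨ B-distribʳ-⊞ (proj₁ (σ s₁)) (proj₁ (σ s₂)) (proj₁ u) ⟨
    B (proj₁ (σ s₁) ⊞ proj₁ (σ s₂)) (proj₁ u)
      ∎

  σ-bijective : Bijective _≡_ _≡_ σ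
  σ-bijective = σ-injective , strictlySurjective⇒surjective (λ t → Inverse.σ t , σ-inverse t)

  σ-lines : ∀ s₁ s₂ s₃ → SingLine s₁ s₂ s₃ → SingLine (σ s₁) (σ s₂) (σ s₃)
  σ-lines s₁ s₂ s₃ (s₁≢s₂ , s₃≡s₁+s₂) = s₁≢s₂ ∘ σ-injective , σ-⊞ s₃≡s₁+s₂

  polarAut : PolarAut (2 + k)
  polarAut = record { bij = mk⤖ σ-bijective ; lines = σ-lines }

f⁻¹ : ∀ {n} → AntiFlag n → NonSingularPoint n
f⁻¹ ((x , x*) , _ , _ , x*x≡1) = (x , x*) , x*x≡1

f∘f⁻¹ : ∀ {n} (a : AntiFlag n) → f (f⁻¹ a) ≡ a
f∘f⁻¹ ((x , x*) , nz₁ , nz₂ , q) =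
  cong₂ (λ p p′ → (x , x*) , p , p′ , q) (Bool-irrelevant _ nz₁) (Bool-irrelevant _ nz₂)

ExactlyOneFalse : Bool → Bool → Set
ExactlyOneFalse p r = (p ≡ false × r ≢ false) ⊎ (r ≡ false × p ≢ false)

exactly-one-false⇒xor : ∀ p r → ExactlyOneFalse p r → r xor p ≡ true
exactly-one-false⇒xor false true  _                 = refl
exactly-one-false⇒xor true  false _                 = refl
exactly-one-false⇒xor false false (inj₁ (_ , r≢0)) = contradiction refl r≢0
exactly-one-false⇒xor false false (inj₂ (_ , p≢0)) = contradiction refl p≢0
exactly-one-false⇒xor true  true  (inj₁ (() , _))
exactly-one-false⇒xor true  true  (inj₂ (() , _))

xor⇒exactly-one-false : ∀ p r → r xor p ≡ true → ExactlyOneFalse p r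
xor⇒exactly-one-false false true  _ = inj₁ (refl , λ ())
xor⇒exactly-one-false true  false _ = inj₂ (refl , λ ())

∼₁⇒B : ∀ {n} (w u : NonSingularPoint n) → f w ∼₁ f u → B (proj₁ w) (proj₁ u) ≡ true
∼₁⇒B ((x , x*) , _) ((y , y*) , _) (_ , one-false) =
  trans (B-formula x x* y y*) (exactly-one-false⇒xor (ev y* x) (ev x* y) one-false)

B⇒∼₁ : ∀ {n} (w u : NonSingularPoint n) → B (proj₁ w) (proj₁ u) ≡ true → f w ∼₁ f u
B⇒∼₁ w@((x , x*) , _) u@((y , y*) , _) B≡1 =
  distinct , xor⇒exactly-one-false (ev y* x) (ev x* y) (trans (sym (B-formula x x* y y*)) B≡1)
  where
  distinct : f w ≢ f u
  distinct fw≡fu with () ← trans (sym (B-self (x , x*))) (trans (cong (B (x , x*) ∘ proj₁ ∘ f⁻¹) fw≡fu) B≡1)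

AutΓ₁⇒NonSingularIsometry : ∀ {n} → AutΓ₁ n → NonSingularIsometry n
AutΓ₁⇒NonSingularIsometry {n} g = record
  { to          = to
  ; from        = λ u → f⁻¹ (G.to⁻ (f u))
  ; to-from     = λ u → cong f⁻¹ (trans (cong G.to (f∘f⁻¹ (G.to⁻ (f u)))) (proj₂ (G.strictlySurjective (f u))))
  ; preserves-B = λ w u → ⇔→≡ (mk⇔ (∼₁⇒B w u ∘ reflect w u ∘ B⇒∼₁ (to w) (to u))
                                    (∼₁⇒B (to w) (to u) ∘ preserve w u ∘ B⇒∼₁ w u))
  }
  where
  module G = Bijection (AutΓ₁.bij g)

  to : NonSingularPoint n → NonSingularPoint n
  to w = f⁻¹ (G.to (f w))

  preserve : ∀ w u → f w ∼₁ f u → f (to w) ∼₁ f (to u)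
  preserve w u = subst₂ _∼₁_ (sym (f∘f⁻¹ _)) (sym (f∘f⁻¹ _)) ∘ proj₁ (AutΓ₁.adj g (f w) (f u))

  reflect : ∀ w u → f (to w) ∼₁ f (to u) → f w ∼₁ f u
  reflect w u = proj₂ (AutΓ₁.adj g (f w) (f u)) ∘ subst₂ _∼₁_ (f∘f⁻¹ _) (f∘f⁻¹ _)

theorem2 : ∀ (n : ℕ) → 3 ≤ n → (g : AutΓ₁ n) →
    Σ (PolarAut n) λ σ →
      ∀ (s : SingularPoint n) (w w′ : NonSingularPoint n) →
        Bijection.to (AutΓ₁.bij g) (f w) ≡ f w′ →
        B (proj₁ s) (proj₁ w) ≡ B (proj₁ (Bijection.to (PolarAut.bij σ) s)) (proj₁ w′)
theorem2 1 (s≤s ()) g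
theorem2 2 (s≤s (s≤s ())) g
theorem2 (suc (suc (suc m))) _ g = polarAut , transports-B
  where
  open InducedPolarAut (AutΓ₁⇒NonSingularIsometry g)

  transports-B : ∀ s w w′ → Bijection.to (AutΓ₁.bij g) (f w) ≡ f w′ →
    B (proj₁ s) (proj₁ w) ≡ B (proj₁ (σ s)) (proj₁ w′)
  transports-B s w w′ gfw≡fw′ = begin
    B (proj₁ s) (proj₁ w)                                             ≡⟨ σ-B s w ⟨
    B (proj₁ (σ s)) (proj₁ (f⁻¹ (Bijection.to (AutΓ₁.bij g) (f w)))) ≡⟨ cong (λ a → B (proj₁ (σ s)) (proj₁ (f⁻¹ a))) gfw≡fw′ ⟩
    B (proj₁ (σ s)) (proj₁ w′)                                        ∎
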